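{- Let $\mathbb{K}$ be a field, let $S\subseteq\mathbb{K}$ be a finite set with $0\in S$ and $|S|\ge k+1$, and let $f\in\mathbb{K}[x_1,\dots,x_n]$ have degree at most $k$. Then $f\equiv 0$ if and only if $f(a)=0$ for all $a\in W^k_n(S)$.
   Context: $W^k_n(S)$ denotes the set of vectors in $S^n$ with at most $k$ nonzero entries. -}

module Defs where

open import Level using (Level; _⊔_)
import Level
open import Algebra.Bundles using (CommutativeRing)
open import Data.Nat using (ℕ; zero; suc; _≤_)
open import Data.Fin using (Fin)
open import Data.Fin.Subset using (Subset; _∉_; ∣_∣)
open import Data.List using (List; []; _∷_; foldr)
open import Data.List.Relation.Unary.All using (All)
open import Data.Vec using (Vec; []; _∷_; lookup)
open import Data.Product using (Σ; ∃; _×_; _,_)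
open import Data.Unit.Polymorphic using (⊤)
open import Relation.Nullary using (¬_)

record Field (c ℓ : Level) : Set (Level.suc (c ⊔ ℓ)) where
  field
    commutativeRing : CommutativeRing c ℓ
  open CommutativeRing commutativeRing public
  field
    0≉1      : ¬ (0# ≈ 1#)
    inverse  : ∀ x → ¬ (x ≈ 0#) → ∃ λ y → (x * y) ≈ 1#

module Poly {c ℓ : Level} (K : Field c ℓ) where
  open Field K using (Carrier; _≈_; 0#; _+_; _*_)

  -- Dense recursive representation of K[x_1,…,x_n]:
  -- Poly 0 = K, and Poly (n+1) = (Poly n)[x_1], i.e. a list [p₀, p₁, …]
  -- standing for Σ_i p_i(x_2,…,x_{n+1}) · x_1^i.
  Pol : ℕ → Set c
  Pol zero    = Carrier
  Pol (suc n) = List (Pol n)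

  IsZero : ∀ n → Pol n → Set (c ⊔ ℓ)
  IsZero zero    a  = Level.Lift c (a ≈ 0#)
  IsZero (suc n) ps = All (IsZero n) ps

  -- f has (total) degree at most k: the coefficient p_i of x_1^i has
  -- degree ≤ k - i, and is zero once i > k.
  DegLe : ∀ n → ℕ → Pol n → Set (c ⊔ ℓ)
  DegLe zero    k       a        = ⊤
  DegLe (suc n) k       []       = ⊤
  DegLe (suc n) zero    (p ∷ ps) = DegLe n zero p × IsZero (suc n) ps
  DegLe (suc n) (suc k) (p ∷ ps) = DegLe n (suc k) p × DegLe (suc n) k ps

  eval : ∀ n → Pol n → Vec Carrier n → Carrier
  eval zero    a  []      = a
  eval (suc n) ps (x ∷ a) = foldr (λ p acc → eval n p a + x * acc) 0# ps

  _∈S_ : Carrier → List Carrier → Set (c ⊔ ℓ)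
  x ∈S S = Data.List.Relation.Unary.Any.Any (λ y → x ≈ y) S
    where import Data.List.Relation.Unary.Any

  W : (k n : ℕ) → List Carrier → Vec Carrier n → Set (c ⊔ ℓ)
  W k n S a =
    (∀ i → lookup a i ∈S S) ×
    Σ (Subset n) (λ P → (∣ P ∣ ≤ k) × (∀ i → i ∉ P → lookup a i ≈ 0#))

-- Induction on the number of variables.  Write f = Σᵢ pᵢ(x₂,…,xₙ) x₁ⁱ with
-- deg pᵢ ≤ k - i.  Evaluating at x₁ = 0 shows that p₀ vanishes on W^k_{n-1}(S).
-- For a ∈ W^{k-1}_{n-1}(S) and t ∈ S the point (t, a) lies in W^k_n(S), so the
-- univariate polynomial t ↦ f(t, a) of degree ≤ k has the |S| ≥ k + 1 roots S;
-- hence every pᵢ(a) vanishes, i.e. p₁, p₂, … vanish on W^{k-1}_{n-1}(S).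
-- Peeling off one coefficient and one unit of degree at a time, the induction
-- hypothesis kills every pᵢ.
module Submission where

open import Defs
open import Level using (_⊔_)
open import Data.Nat using (ℕ; zero; suc; _≤_; z≤n; s≤s)
open import Data.Nat.Properties using (m≤n⇒m≤1+n; <⇒≤)
open import Data.List using (List; []; _∷_; length; foldr; map; drop)
open import Data.List.Relation.Unary.All as All using (All; []; _∷_)
open import Data.List.Relation.Unary.All.Properties using (map⁺)
open import Data.List.Relation.Unary.AllPairs using (AllPairs; []; _∷_)
open import Data.List.Relation.Unary.Unique.Setoid using (Unique)
open import Data.Vec using (Vec; []; _∷_; here; there)
open import Data.Fin using (Fin)
open import Data.Bool using (true; false)
open import Data.Product using (_,_)
open import Data.Empty using (⊥-elim)
open import Data.Maybe using (nothing)
open import Function.Base using (_∘_)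
open import Function.Bundles using (_⇔_; mk⇔)
open import Relation.Nullary using (¬_)
open import Relation.Binary.PropositionalEquality as ≡ using (_≡_)
open import Algebra.Bundles using (CommutativeRing)
import Algebra.Properties.Group as GroupProperties
open import Tactic.RingSolver.Core.AlmostCommutativeRing using (AlmostCommutativeRing; fromCommutativeRing)
open import Tactic.RingSolver using (solve-∀)

module FieldProperties {c ℓ} (K : Field c ℓ) where
  open Field K
  open GroupProperties +-group using (x∙y⁻¹≈ε⇒x≈y; //-rightDividesˡ)
  open import Relation.Binary.Reasoning.Setoid setoid

  x≉0⇒x*y≈0⇒y≈0 : ∀ {x y} → ¬ (x ≈ 0#) → x * y ≈ 0# → y ≈ 0#
  x≉0⇒x*y≈0⇒y≈0 {x} {y} x≉0 xy≈0 with inverse x x≉0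
  ... | x⁻¹ , xx⁻¹≈1 = begin
    y               ≈⟨ *-identityˡ y ⟨
    1# * y          ≈⟨ *-congʳ xx⁻¹≈1 ⟨
    (x * x⁻¹) * y   ≈⟨ *-congʳ (*-comm x x⁻¹) ⟩
    (x⁻¹ * x) * y   ≈⟨ *-assoc x⁻¹ x y ⟩
    x⁻¹ * (x * y)   ≈⟨ *-congˡ xy≈0 ⟩
    x⁻¹ * 0#        ≈⟨ zeroʳ x⁻¹ ⟩
    0#              ∎

  x+y*0≈x : ∀ x y → x + y * 0# ≈ x
  x+y*0≈x x y = trans (+-congˡ (zeroʳ y)) (+-identityʳ x)

  x+0*y≈x : ∀ x y → x + 0# * y ≈ x
  x+0*y≈x x y = trans (+-congˡ (zeroˡ y)) (+-identityʳ x)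

  x≉y⇒x-y≉0 : ∀ {x y} → ¬ (x ≈ y) → ¬ (x - y ≈ 0#)
  x≉y⇒x-y≉0 {x} {y} x≉y = x≉y ∘ x∙y⁻¹≈ε⇒x≈y x y

  y+[x-y]≈x : ∀ x y → y + (x - y) ≈ x
  y+[x-y]≈x x y = trans (+-comm y (x - y)) (//-rightDividesˡ y x)

module FactorIdentity {c ℓ} (R : CommutativeRing c ℓ) where
  private
    ACR : AlmostCommutativeRing c ℓ
    ACR = fromCommutativeRing R (λ _ → nothing)

  open AlmostCommutativeRing ACR using (_+_; _*_; -_; _≈_)

  factor-step : ∀ c t d h q → c + (t + d) * (h + d * q) ≈ (c + t * h) + d * (h + (t + d) * q)
  factor-step = solve-∀ ACR

-- Univariate polynomials as coefficient lists [c₀, c₁, …] (constant term first).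
module Univariate {c ℓ} (K : Field c ℓ) where
  open Field K hiding (zero)
  open FieldProperties K
  open FactorIdentity commutativeRing
  open import Relation.Binary.Reasoning.Setoid setoid

  horner : Carrier → List Carrier → Carrier
  horner x = foldr (λ c acc → c + x * acc) 0#

  Root : List Carrier → Carrier → Set ℓ
  Root cs t = horner t cs ≈ 0#

  AllZero : List Carrier → Set (c ⊔ ℓ)
  AllZero = All (_≈ 0#)

  DegreeBelow : ℕ → List Carrier → Set (c ⊔ ℓ)
  DegreeBelow m cs = AllZero (drop m cs)

  Distinct : List Carrier → Set (c ⊔ ℓ)
  Distinct = AllPairs (λ x y → ¬ (x ≈ y))

  -- Synthetic division by (x - t): the i-th coefficient is horner t (drop (i + 1) cs).
  quotient : Carrier → List Carrier → List Carrier
  quotient t []       = []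
  quotient t (c ∷ cs) = horner t cs ∷ quotient t cs

  horner-allZero : ∀ x {cs} → AllZero cs → horner x cs ≈ 0#
  horner-allZero x []           = refl
  horner-allZero x (c≈0 ∷ cs≈0) = trans (+-cong c≈0 (*-congˡ (horner-allZero x cs≈0))) (x+y*0≈x 0# x)

  quotient-allZero : ∀ t {cs} → AllZero cs → AllZero (quotient t cs)
  quotient-allZero t []          = []
  quotient-allZero t (_ ∷ cs≈0) = horner-allZero t cs≈0 ∷ quotient-allZero t cs≈0

  quotient-degreeBelow : ∀ t m cs → DegreeBelow (suc m) cs → DegreeBelow m (quotient t cs)
  quotient-degreeBelow t zero    []       _   = []
  quotient-degreeBelow t (suc m) []       _   = []
  quotient-degreeBelow t zero    (c ∷ cs) deg = horner-allZero t deg ∷ quotient-allZero t deg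
  quotient-degreeBelow t (suc m) (c ∷ cs) deg = quotient-degreeBelow t m cs deg

  horner-factor : ∀ x t cs → horner x cs ≈ horner t cs + (x - t) * horner x (quotient t cs)
  horner-factor x t []       = sym (x+y*0≈x 0# (x - t))
  horner-factor x t (c ∷ cs) = begin
    c + x * horner x cs                              ≈⟨ +-congˡ (*-congˡ (horner-factor x t cs)) ⟩
    c + x * (h + (x - t) * q)                        ≈⟨ +-congˡ (*-congʳ x≈t+[x-t]) ⟩
    c + (t + (x - t)) * (h + (x - t) * q)            ≈⟨ factor-step c t (x - t) h q ⟩
    (c + t * h) + (x - t) * (h + (t + (x - t)) * q)  ≈⟨ +-congˡ (*-congˡ (+-congˡ (*-congʳ x≈t+[x-t]))) ⟨
    (c + t * h) + (x - t) * (h + x * q)              ∎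
    where
    h = horner t cs
    q = horner x (quotient t cs)
    x≈t+[x-t] = sym (y+[x-y]≈x x t)

  quotient-root : ∀ {t y} cs → Root cs t → ¬ (t ≈ y) → Root cs y → Root (quotient t cs) y
  quotient-root {t} {y} cs root-t t≉y root-y = x≉0⇒x*y≈0⇒y≈0 (x≉y⇒x-y≉0 (t≉y ∘ sym)) (begin
    (y - t) * horner y (quotient t cs)                ≈⟨ +-identityˡ _ ⟨
    0# + (y - t) * horner y (quotient t cs)           ≈⟨ +-congʳ root-t ⟨
    horner t cs + (y - t) * horner y (quotient t cs)  ≈⟨ horner-factor y t cs ⟨
    horner y cs                                       ≈⟨ root-y ⟩
    0#                                                ∎)

  quotient-allZero⇒allZero : ∀ t cs → Root cs t → AllZero (quotient t cs) → AllZero cs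
  quotient-allZero⇒allZero t []       _      _              = []
  quotient-allZero⇒allZero t (c ∷ cs) root-t (q₀≈0 ∷ qs≈0) =
    trans (sym (trans (+-congˡ (*-congˡ q₀≈0)) (x+y*0≈x c t))) root-t
    ∷ quotient-allZero⇒allZero t cs q₀≈0 qs≈0

  roots⇒allZero : ∀ m cs → DegreeBelow m cs → ∀ ts → Distinct ts → m ≤ length ts →
                  All (Root cs) ts → AllZero cs
  roots⇒allZero zero    cs deg _        _                _         _                = deg
  roots⇒allZero (suc m) cs deg (t ∷ ts) (t∉ts ∷ distinct) (s≤s m≤ts) (root-t ∷ roots) =
    quotient-allZero⇒allZero t cs root-t
      (roots⇒allZero m (quotient t cs) (quotient-degreeBelow t m cs deg) ts distinct m≤ts
        (All.zipWith (λ (t≉y , root-y) → quotient-root cs root-t t≉y root-y) (t∉ts , roots)))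

module Multivariate {c ℓ} (K : Field c ℓ) where
  open Field K hiding (zero)
  open FieldProperties K
  open Univariate K
  open Poly K

  coefficientsAt : ∀ n → Vec Carrier n → List (Pol n) → List Carrier
  coefficientsAt n a = map (λ p → eval n p a)

  eval-horner : ∀ n ps x a → eval (suc n) ps (x ∷ a) ≡ horner x (coefficientsAt n a ps)
  eval-horner n []       x a = ≡.refl
  eval-horner n (p ∷ ps) x a = ≡.cong (λ v → eval n p a + x * v) (eval-horner n ps x a)

  isZero⇒eval≈0 : ∀ n f → IsZero n f → ∀ a → eval n f a ≈ 0#
  allIsZero⇒coefficientsAt-allZero : ∀ n {ps} a → All (IsZero n) ps → AllZero (coefficientsAt n a ps)

  isZero⇒eval≈0 zero    f  (Level.lift f≈0) [] = f≈0
  isZero⇒eval≈0 (suc n) ps ps≈0            (x ∷ a) =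
    trans (reflexive (eval-horner n ps x a)) (horner-allZero x (allIsZero⇒coefficientsAt-allZero n a ps≈0))

  allIsZero⇒coefficientsAt-allZero n a ps≈0 = map⁺ (All.map (λ {p} p≈0 → isZero⇒eval≈0 n p p≈0 a) ps≈0)

  coefficientsAt-degreeBelow : ∀ n k ps a → DegLe (suc n) k ps → DegreeBelow (suc k) (coefficientsAt n a ps)
  coefficientsAt-degreeBelow n k       []       a _            = []
  coefficientsAt-degreeBelow n zero    (p ∷ ps) a (_ , ps≈0)   = allIsZero⇒coefficientsAt-allZero n a ps≈0
  coefficientsAt-degreeBelow n (suc k) (p ∷ ps) a (_ , deg-ps) = coefficientsAt-degreeBelow n k ps a deg-ps

  module _ (S : List Carrier) where

    W-[] : ∀ k → W k 0 S []
    W-[] k = (λ ()) , [] , z≤n , (λ ())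

    W-∷ : ∀ {k n t a} → t ∈S S → W k n S a → W (suc k) (suc n) S (t ∷ a)
    W-∷ t∈S (a∈S , P , |P|≤k , a∉P≈0) =
      (λ { Fin.zero → t∈S ; (Fin.suc i) → a∈S i }) , (true ∷ P) , s≤s |P|≤k ,
      (λ { Fin.zero 0∉P → ⊥-elim (0∉P here)
         ; (Fin.suc i) i+1∉P → a∉P≈0 i (i+1∉P ∘ there) })

    W-0∷ : ∀ {k n a} → 0# ∈S S → W k n S a → W k (suc n) S (0# ∷ a)
    W-0∷ 0∈S (a∈S , P , |P|≤k , a∉P≈0) =
      (λ { Fin.zero → 0∈S ; (Fin.suc i) → a∈S i }) , (false ∷ P) , |P|≤k ,
      (λ { Fin.zero _ → refl
         ; (Fin.suc i) i+1∉P → a∉P≈0 i (i+1∉P ∘ there) })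

    W-mono : ∀ {k n} a → W k n S a → W (suc k) n S a
    W-mono _ (a∈S , P , |P|≤k , a∉P≈0) = a∈S , P , m≤n⇒m≤1+n |P|≤k , a∉P≈0

  module Vanishing (S : List Carrier) (distinct : Distinct S) (0∈S : 0# ∈S S) where

    VanishesOn : ℕ → ∀ n → Pol n → Set (c ⊔ ℓ)
    VanishesOn k n f = ∀ a → W k n S a → eval n f a ≈ 0#

    CoefficientsVanishOn : ℕ → ∀ n → List (Pol n) → Set (c ⊔ ℓ)
    CoefficientsVanishOn k n ps = ∀ a → W k n S a → AllZero (coefficientsAt n a ps)

    VanishingPrinciple : ℕ → Set (c ⊔ ℓ)
    VanishingPrinciple n = ∀ k (f : Pol n) → suc k ≤ length S → DegLe n k f → VanishesOn k n f → IsZero n f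

    vanishesOn-constantCoefficient : ∀ {k n p ps} → VanishesOn k (suc n) (p ∷ ps) → VanishesOn k n p
    vanishesOn-constantCoefficient {n = n} {p} vanishes a w =
      trans (sym (x+0*y≈x (eval n p a) _)) (vanishes (0# ∷ a) (W-0∷ S 0∈S w))

    -- Every t ∈ S extends a ∈ W^k to (t, a) ∈ W^{k+1}, so x₁ ↦ f(x₁, a) has the roots S.
    vanishesOn⇒coefficientsVanishOn : ∀ n k ps → suc (suc k) ≤ length S → DegLe (suc n) (suc k) ps →
                                      VanishesOn (suc k) (suc n) ps → CoefficientsVanishOn k n ps
    vanishesOn⇒coefficientsVanishOn n k ps k+1<|S| deg vanishes a w =
      roots⇒allZero (suc (suc k)) (coefficientsAt n a ps) (coefficientsAt-degreeBelow n (suc k) ps a deg)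
        S distinct k+1<|S| (All.tabulateₛ setoid root)
      where
      root : ∀ {t} → t ∈S S → Root (coefficientsAt n a ps) t
      root {t} t∈S = trans (reflexive (≡.sym (eval-horner n ps t a))) (vanishes (t ∷ a) (W-∷ S t∈S w))

    coefficientsVanishOn⇒allIsZero : ∀ {n} → VanishingPrinciple n → ∀ k ps → suc k ≤ length S →
                                     DegLe (suc n) k ps → CoefficientsVanishOn k n ps → All (IsZero n) ps
    coefficientsVanishOn⇒allIsZero principle k       []       _       _                 _        = []
    coefficientsVanishOn⇒allIsZero principle zero    (q ∷ qs) 0<|S|   (deg-q , qs≈0)    vanish =
      principle zero q 0<|S| deg-q (λ a w → All.head (vanish a w)) ∷ qs≈0
    coefficientsVanishOn⇒allIsZero principle (suc k) (q ∷ qs) k+1<|S| (deg-q , deg-qs) vanish =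
      principle (suc k) q k+1<|S| deg-q (λ a w → All.head (vanish a w))
      ∷ coefficientsVanishOn⇒allIsZero principle k qs (<⇒≤ k+1<|S|) deg-qs
          (λ a w → All.tail (vanish a (W-mono S a w)))

    vanishingPrinciple : ∀ n → VanishingPrinciple n
    vanishingPrinciple zero    k       f        _       _                 vanishes =
      Level.lift (vanishes [] (W-[] S k))
    vanishingPrinciple (suc n) k       []       _       _                 _        = []
    vanishingPrinciple (suc n) zero    (p ∷ ps) 0<|S|   (deg-p , ps≈0)    vanishes =
      vanishingPrinciple n zero p 0<|S| deg-p (vanishesOn-constantCoefficient vanishes) ∷ ps≈0
    vanishingPrinciple (suc n) (suc k) (p ∷ ps) k+1<|S| deg@(deg-p , deg-ps) vanishes =
      vanishingPrinciple n (suc k) p k+1<|S| deg-p (vanishesOn-constantCoefficient vanishes)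
      ∷ coefficientsVanishOn⇒allIsZero (vanishingPrinciple n) k ps (<⇒≤ k+1<|S|) deg-ps
          (λ a w → All.tail (vanishesOn⇒coefficientsVanishOn n k (p ∷ ps) k+1<|S| deg vanishes a w))

lemma4 : ∀ {c ℓ} (K : Field c ℓ) (n k : ℕ) (S : List (Field.Carrier K)) →
    Unique (CommutativeRing.setoid (Field.commutativeRing K)) S →
    Poly._∈S_ K (Field.0# K) S →
    suc k ≤ length S →
    (f : Poly.Pol K n) → Poly.DegLe K n k f →
    Poly.IsZero K n f
      ⇔ (∀ (a : Vec (Field.Carrier K) n) → Poly.W K k n S a → Field._≈_ K (Poly.eval K n f a) (Field.0# K))
lemma4 K n k S distinct 0∈S k<|S| f deg =
  mk⇔ (λ f≈0 a _ → isZero⇒eval≈0 n f f≈0 a) (vanishingPrinciple n k f k<|S| deg)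
  where
  open Multivariate K
  open Vanishing S distinct 0∈S
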